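{- Let $n,m,p$ be positive integers and let $G$ be the complete bipartite graph $K_{n,n}$ (without multiple edges), with bipartition $U\cup V$. (1) If $p>\lceil n/m\rceil$, then there exists a shuffle-preserved $m$-coloring (and hence a shuffle-preserved $m$-local coloring) of $G$ such that $G$ contains no monochromatic copy of $K_{p,p}$. (2) If $n=2^k$, $m=3\cdot 2^{k-2}$ and $p=2$ for some integer $k\ge 2$, then there exists a shuffle-preserved $m$-local coloring of $G$ such that $G$ contains no monochromatic copy of $K_{p,p}$.
   Context: A coloring assigns a color to each edge. An $m$-coloring uses at most $m$ distinct colors in total. For a vertex $u$, $C(u)$ is the set of colors on edges incident to $u$; a coloring is $m$-local if $|C(u)|\le m$ for every vertex $u$. Write $(u,v)_c$ if the edge $uv$ has color $c$. A coloring is shuffle-preserved if for all $u,u'\in U$, $v,v'\in V$ and every color $c$, $(u,v)_c$ and $(u',v')_c$ imply $(u,v')_c$ and $(u',v)_c$. A monochromatic copy of $K_{p,p}$ consists of $A\subseteq U$, $B\subseteq V$ with $|A|=|B|=p$ and a color $c$ with $(a,b)_c$ for all $a\in A$, $b\in B$. -}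

module Defs where

open import Data.Nat using (ℕ; suc; _+_; _∸_; _≤_; NonZero)
open import Data.Nat.DivMod using (_/_)
open import Data.Fin using (Fin)
open import Data.List using (List; length)
open import Data.List.Membership.Propositional using (_∈_)
open import Data.Product using (Σ; _×_; ∃; ∃-syntax)
open import Function.Definitions using (Injective)
open import Relation.Binary.PropositionalEquality using (_≡_)

⌈_/_⌉ : ℕ → (m : ℕ) → .{{NonZero m}} → ℕ
⌈ n / m ⌉ = (n + (m ∸ 1)) / m

-- An edge coloring of K_{n,n} with parts U = Fin n, V = Fin n,
-- colors taken from ℕ: χ u v is the color of edge uv.
Coloring : ℕ → Set
Coloring n = Fin n → Fin n → ℕ

IsMColoring : ∀ {n} → ℕ → Coloring n → Set
IsMColoring {n} m χ =
  ∃[ L ] (length L ≤ m × (∀ (u v : Fin n) → χ u v ∈ L))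

IsMLocal : ∀ {n} → ℕ → Coloring n → Set
IsMLocal {n} m χ =
  (∀ (u : Fin n) → ∃[ L ] (length L ≤ m × (∀ (v : Fin n) → χ u v ∈ L)))
  × (∀ (v : Fin n) → ∃[ L ] (length L ≤ m × (∀ (u : Fin n) → χ u v ∈ L)))

ShufflePreserved : ∀ {n} → Coloring n → Set
ShufflePreserved {n} χ =
  ∀ (u u' v v' : Fin n) (c : ℕ) → χ u v ≡ c → χ u' v' ≡ c →
  (χ u v' ≡ c × χ u' v ≡ c)

MonoKpp : ∀ {n} → ℕ → Coloring n → Set
MonoKpp {n} p χ =
  Σ (Fin p → Fin n) λ a → Σ (Fin p → Fin n) λ b → Σ ℕ λ c →
    Injective _≡_ _≡_ a × Injective _≡_ _≡_ b ×
    (∀ (i j : Fin p) → χ (a i) (b j) ≡ c)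

-- (1) Color each vertex u ∈ U in block ⌊u/q⌋, q = ⌈n/m⌉, and give every edge the color of
-- its U-end. There are at most m blocks, each color class is "block × V" so the coloring is
-- shuffle-preserved, and a monochromatic K_{p,p} would need p > q rows inside one block.
-- (2) Split U and V into lower and upper halves of size h = n/2. An edge inside a half gets
-- a color naming its U-end, an edge across the halves one naming its V-end. Every color
-- class is then a star, which is shuffle-preserved and contains no K_{2,2}; a vertex sees its
-- own color and at most h others, and h + 1 ≤ 3 · 2^(k-2).
module Submission where

open import Defs
open import Data.Nat using (ℕ; suc; _+_; _*_; _^_; _<_)
open import Data.Product using (_×_; ∃-syntax)
open import Relation.Nullary using (¬_)
open import Data.Nat using (_≤_; _>_; _∸_; NonZero; >-nonZero; s≤s; _/_; _%_; _<?_)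
open import Data.Nat.Properties
open import Data.Nat.DivMod using (m≡m%n+[m/n]*n; m%n<n; m<n*o⇒m/o<n; m≥n⇒m/n>0; _mod_; _divMod_; DivMod)
open import Data.Fin using (Fin; zero; suc; toℕ)
import Data.Fin.Properties as Fin
open import Data.Bool using (Bool; true; false; not; _xor_)
open import Data.List using (List; _∷_; map; upTo; applyUpTo; length)
open import Data.List.Membership.Propositional using (_∈_)
open import Data.List.Membership.Propositional.Properties using (∈-map⁺; ∈-upTo⁺; ∈-applyUpTo⁺)
open import Data.List.Relation.Unary.Any using (here; there)
open import Data.List.Properties using (length-map; length-upTo; length-applyUpTo)
open import Data.Product using (_,_)
open import Data.Sum using (_⊎_; inj₁; inj₂)
import Data.Sum as Sum
open import Function.Base using (_∘_)
open import Function.Definitions using (Injective)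
open import Relation.Nullary using (yes; no; contradiction)
open import Relation.Nullary.Decidable using (⌊_⌋)
open import Relation.Binary.PropositionalEquality

module _ {n : ℕ} where

  bounded⇒isMColoring : ∀ {m} (χ : Coloring n) → (∀ u v → χ u v < m) → IsMColoring m χ
  bounded⇒isMColoring {m} χ χ<m =
    upTo m , ≤-reflexive (length-upTo m) , λ u v → ∈-upTo⁺ (χ<m u v)

  isMLocal-mono : ∀ {m m'} {χ : Coloring n} → m ≤ m' → IsMLocal m χ → IsMLocal m' χ
  isMLocal-mono m≤m' (rows , cols) =
    (λ u → let L , |L|≤m , χ∈L = rows u in L , ≤-trans |L|≤m m≤m' , χ∈L) ,
    (λ v → let L , |L|≤m , χ∈L = cols v in L , ≤-trans |L|≤m m≤m' , χ∈L)

  rowColoring : (Fin n → ℕ) → Coloring n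
  rowColoring f u v = f u

  rowColoring-shufflePreserved : ∀ f → ShufflePreserved (rowColoring f)
  rowColoring-shufflePreserved f u u' v v' c fu≡c fu'≡c = fu≡c , fu'≡c

  StarClasses : Coloring n → Set
  StarClasses χ = ∀ {u v u' v'} → χ u v ≡ χ u' v' → u ≡ u' ⊎ v ≡ v'

  starClasses⇒shufflePreserved : ∀ {χ} → StarClasses χ → ShufflePreserved χ
  starClasses⇒shufflePreserved star u u' v v' c χuv≡c χu'v'≡c
    with star (trans χuv≡c (sym χu'v'≡c))
  ... | inj₁ refl = χu'v'≡c , χuv≡c
  ... | inj₂ refl = χuv≡c , χu'v'≡c

  starClasses⇒¬MonoKpp : ∀ {χ} p → StarClasses χ → ¬ MonoKpp (2 + p) χ
  starClasses⇒¬MonoKpp p star (a , b , c , a-inj , b-inj , mono)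
    with star (trans (mono zero zero) (sym (mono (suc zero) (suc zero))))
  ... | inj₁ a₀≡a₁ = Fin.0≢1+n (a-inj a₀≡a₁)
  ... | inj₂ b₀≡b₁ = Fin.0≢1+n (b-inj b₀≡b₁)

m≤⌈m/n⌉*n : ∀ m n .{{_ : NonZero n}} → m ≤ ⌈ m / n ⌉ * n
m≤⌈m/n⌉*n m n@(suc n-1) = +-cancelʳ-≤ n-1 m (q * n) (begin
  m + n-1                   ≡⟨ m≡m%n+[m/n]*n (m + n-1) n ⟩
  (m + n-1) % n + q * n     ≤⟨ +-monoˡ-≤ (q * n) (≤-pred (m%n<n (m + n-1) n)) ⟩
  n-1 + q * n               ≡⟨ +-comm n-1 (q * n) ⟩
  q * n + n-1               ∎)
  where
  q = ⌈ m / n ⌉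
  open ≤-Reasoning

⌈1+m/n⌉>0 : ∀ m n .{{_ : NonZero n}} → ⌈ suc m / n ⌉ > 0
⌈1+m/n⌉>0 m (suc n-1) = m≥n⇒m/n>0 (s≤s (m≤n+m n-1 m))

div-mod-injective : ∀ {x y q} .{{_ : NonZero q}} → x / q ≡ y / q → x mod q ≡ y mod q → x ≡ y
div-mod-injective {x} {y} {q} x/q≡y/q x%q≡y%q = begin
  x                         ≡⟨ DivMod.property (x divMod q) ⟩
  toℕ (x mod q) + x / q * q ≡⟨ cong₂ (λ r d → toℕ r + d * q) x%q≡y%q x/q≡y/q ⟩
  toℕ (y mod q) + y / q * q ≡⟨ DivMod.property (y divMod q) ⟨
  y                         ∎
  where open ≡-Reasoning

injective⇒¬constant-quotient : ∀ {k q} .{{_ : NonZero q}} → q < k → (a : Fin k → ℕ) →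
  Injective _≡_ _≡_ a → ¬ (∀ i j → a i / q ≡ a j / q)
injective⇒¬constant-quotient {q = q} q<k a a-inj same-quotient
  with Fin.pigeonhole q<k (λ i → a i mod q)
... | i , j , i<j , aᵢ%q≡aⱼ%q =
  Fin.<⇒≢ i<j (a-inj (div-mod-injective (same-quotient i j) aᵢ%q≡aⱼ%q))

blockColoring : ∀ {n} q .{{_ : NonZero q}} → Coloring n
blockColoring q = rowColoring (λ u → toℕ u / q)

blockColoring-¬MonoKpp : ∀ {n p} q .{{_ : NonZero q}} → q < suc p →
  ¬ MonoKpp (suc p) (blockColoring {n} q)
blockColoring-¬MonoKpp q q<p (a , b , c , a-inj , b-inj , mono) =
  injective⇒¬constant-quotient q<p (toℕ ∘ a) (a-inj ∘ Fin.toℕ-injective)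
    (λ i j → trans (mono i zero) (sym (mono j zero)))

blockColoring-isMColoring : ∀ {n m} q .{{_ : NonZero q}} → n ≤ q * m →
  IsMColoring m (blockColoring {n} q)
blockColoring-isMColoring {n} {m} q n≤qm = bounded⇒isMColoring (blockColoring q) λ u v →
  m<n*o⇒m/o<n (<-≤-trans (Fin.toℕ<n u) (≤-trans n≤qm (≤-reflexive (*-comm q m))))

endpoint : (crossing : Bool) → ℕ → ℕ → ℕ ⊎ ℕ
endpoint false x y = inj₁ x
endpoint true  x y = inj₂ y

endpoint-shares-end : ∀ b b' {x y x' y'} → endpoint b x y ≡ endpoint b' x' y' →
  x ≡ x' ⊎ y ≡ y'
endpoint-shares-end false false refl = inj₁ refl
endpoint-shares-end true  true  refl = inj₂ refl

endpoint-∈-row : ∀ (H : Bool → List ℕ) s t {x y} → y ∈ H t →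
  endpoint (s xor t) x y ∈ inj₁ x ∷ map inj₂ (H (not s))
endpoint-∈-row H true  true  y∈H = here refl
endpoint-∈-row H true  false y∈H = there (∈-map⁺ inj₂ y∈H)
endpoint-∈-row H false false y∈H = here refl
endpoint-∈-row H false true  y∈H = there (∈-map⁺ inj₂ y∈H)

endpoint-∈-column : ∀ (H : Bool → List ℕ) s t {x y} → x ∈ H s →
  endpoint (s xor t) x y ∈ inj₂ y ∷ map inj₁ (H t)
endpoint-∈-column H true  true  x∈H = there (∈-map⁺ inj₁ x∈H)
endpoint-∈-column H true  false x∈H = here refl
endpoint-∈-column H false false x∈H = there (∈-map⁺ inj₁ x∈H)
endpoint-∈-column H false true  x∈H = here refl

tag : ℕ ⊎ ℕ → ℕ
tag (inj₁ x) = 2 * x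
tag (inj₂ y) = suc (2 * y)

tag-injective : Injective _≡_ _≡_ tag
tag-injective {inj₁ x} {inj₁ x'} 2x≡2x'     = cong inj₁ (*-cancelˡ-≡ x x' 2 2x≡2x')
tag-injective {inj₁ x} {inj₂ y'} 2x≡1+2y'   = contradiction 2x≡1+2y' (even≢odd x y')
tag-injective {inj₂ y} {inj₁ x'} 1+2y≡2x'   = contradiction (sym 1+2y≡2x') (even≢odd x' y)
tag-injective {inj₂ y} {inj₂ y'} 1+2y≡1+2y' = cong inj₂ (*-cancelˡ-≡ y y' 2 (suc-injective 1+2y≡1+2y'))

module Halves (h : ℕ) where

  lower : ℕ → Bool
  lower x = ⌊ x <? h ⌋

  half : Bool → List ℕ
  half true  = upTo h
  half false = applyUpTo (_+ h) h

  length-half : ∀ s → length (half s) ≡ h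
  length-half true  = length-upTo h
  length-half false = length-applyUpTo (_+ h) h

  ∈-half : ∀ {x} → x < 2 * h → x ∈ half (lower x)
  ∈-half {x} x<2h with x <? h
  ... | yes x<h = ∈-upTo⁺ x<h
  ... | no  x≮h = subst (_∈ half false) (m∸n+n≡m h≤x)
                    (∈-applyUpTo⁺ (_+ h) x∸h<h)
    where
    h≤x = ≮⇒≥ x≮h
    x∸h<h : x ∸ h < h
    x∸h<h = subst (x ∸ h <_) (trans (m+n∸m≡n h (h + 0)) (+-identityʳ h)) (∸-monoˡ-< x<2h h≤x)

  crossColoring : Coloring (2 * h)
  crossColoring u v = tag (endpoint (lower (toℕ u) xor lower (toℕ v)) (toℕ u) (toℕ v))

  crossColoring-starClasses : StarClasses crossColoring
  crossColoring-starClasses {u} {v} {u'} {v'} χuv≡χu'v' =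
    Sum.map Fin.toℕ-injective Fin.toℕ-injective
      (endpoint-shares-end (lower (toℕ u) xor lower (toℕ v)) (lower (toℕ u') xor lower (toℕ v'))
        (tag-injective χuv≡χu'v'))

  rowColors columnColors : ℕ → List ℕ
  rowColors    x = map tag (inj₁ x ∷ map inj₂ (half (not (lower x))))
  columnColors y = map tag (inj₂ y ∷ map inj₁ (half (lower y)))

  length-tagged : ∀ c (f : ℕ → ℕ ⊎ ℕ) s → length (map tag (c ∷ map f (half s))) ≡ suc h
  length-tagged c f s = begin
    length (map tag (c ∷ map f (half s))) ≡⟨ length-map tag (c ∷ map f (half s)) ⟩
    suc (length (map f (half s)))         ≡⟨ cong suc (length-map f (half s)) ⟩
    suc (length (half s))                 ≡⟨ cong suc (length-half s) ⟩
    suc h                                 ∎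
    where open ≡-Reasoning

  crossColoring-isMLocal : IsMLocal (suc h) crossColoring
  crossColoring-isMLocal =
    (λ u → let x = toℕ u in
      rowColors x , ≤-reflexive (length-tagged (inj₁ x) inj₂ (not (lower x))) ,
      λ v → ∈-map⁺ tag (endpoint-∈-row half (lower x) (lower (toℕ v)) (∈-half (Fin.toℕ<n v)))) ,
    (λ v → let y = toℕ v in
      columnColors y , ≤-reflexive (length-tagged (inj₂ y) inj₁ (lower y)) ,
      λ u → ∈-map⁺ tag (endpoint-∈-column half (lower (toℕ u)) (lower y) (∈-half (Fin.toℕ<n u))))

open Halves using (crossColoring; crossColoring-starClasses; crossColoring-isMLocal)

2^[1+j]<3*2^j : ∀ j → 2 ^ suc j < 3 * 2 ^ j
2^[1+j]<3*2^j j = +-monoˡ-≤ (2 ^ j + (2 ^ j + 0)) (m^n>0 2 j)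

lemma1 : (∀ (n m p : ℕ) → ⌈ suc n / suc m ⌉ < suc p →
    ∃[ χ ] (IsMColoring {suc n} (suc m) χ × ShufflePreserved χ × ¬ MonoKpp (suc p) χ))
    × (∀ (j : ℕ) →
    ∃[ χ ] (IsMLocal {2 ^ (2 + j)} (3 * 2 ^ j) χ × ShufflePreserved χ × ¬ MonoKpp 2 χ))
lemma1 =
  (λ n m p ⌈n/m⌉<p →
    let q = ⌈ suc n / suc m ⌉
        instance _ = >-nonZero (⌈1+m/n⌉>0 n (suc m))
    in blockColoring q ,
       blockColoring-isMColoring q (m≤⌈m/n⌉*n (suc n) (suc m)) ,
       rowColoring-shufflePreserved _ ,
       blockColoring-¬MonoKpp q ⌈n/m⌉<p) ,
  (λ j →
    let h = 2 ^ suc j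
    in crossColoring h ,
       isMLocal-mono (2^[1+j]<3*2^j j) (crossColoring-isMLocal h) ,
       starClasses⇒shufflePreserved (crossColoring-starClasses h) ,
       starClasses⇒¬MonoKpp 0 (crossColoring-starClasses h))
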